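{- If $G$ is a connected graph in which every vertex is incident with a $2$-cycle or with a $3$-cycle, then $G$ has the strong parity property.
   Context: Graphs may have loops and multiple edges; the degree $\deg_G(v)$ counts each loop twice. A $2$-cycle is a pair of parallel edges (two edges with the same two distinct endpoints); a $3$-cycle is a cycle of length $3$ (a triangle). A factor of $G$ is a spanning subgraph $H$ of $G$ with minimum degree $\delta(H)\ge 1$. For a set $X\subseteq V(G)$ of even cardinality, an $X$-parity-factor of $G$ is a factor $H$ of $G$ such that $\deg_H(v)$ is odd for every $v\in X$ and $\deg_H(v)$ is even for every $v\in V(G)\setminus X$. A graph $G$ has the strong parity property if for every subset $X\subseteq V(G)$ of even cardinality (including $X=\emptyset$), $G$ has an $X$-parity-factor. -}

module Defs where

open import Data.Nat using (ℕ; zero; suc; _+_; _≥_)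
open import Data.Nat.Divisibility using (_∣_)
open import Data.Fin using (Fin; _≟_)
open import Data.Fin.Subset using (Subset; _∈_; _∉_; ∣_∣)
open import Data.Bool using (Bool; true; false; if_then_else_)
open import Data.List using (List; map; allFin)
open import Data.Nat.ListAction using (sum)
open import Data.Product using (_×_; _,_; proj₁; proj₂; Σ; ∃; ∃-syntax)
open import Data.Sum using (_⊎_)
open import Relation.Nullary using (¬_)
open import Relation.Nullary.Decidable using (⌊_⌋)
open import Relation.Binary.PropositionalEquality using (_≡_)

-- A finite multigraph (loops and parallel edges allowed):
-- vertices Fin n, edges Fin m, each edge has an (unordered) pair of endpoints.
-- An edge e with endpoints (x , x) is a loop.
record Graph : Set where
  field
    n    : ℕ
    m    : ℕ
    ends : Fin m → Fin n × Fin n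
open Graph public

Vertex : Graph → Set
Vertex G = Fin (n G)

Edge : Graph → Set
Edge G = Fin (m G)

Joins : (G : Graph) → Edge G → Vertex G → Vertex G → Set
Joins G e x y = ends G e ≡ (x , y) ⊎ ends G e ≡ (y , x)

-- number of ends of edge e at v (a loop at v contributes 2)
incid : (G : Graph) → Edge G → Vertex G → ℕ
incid G e v =
  (if ⌊ proj₁ (ends G e) ≟ v ⌋ then 1 else 0) +
  (if ⌊ proj₂ (ends G e) ≟ v ⌋ then 1 else 0)

SpanningSubgraph : Graph → Set
SpanningSubgraph G = Subset (m G)

deg : (G : Graph) → SpanningSubgraph G → Vertex G → ℕ
deg G H v = sum (map (λ e → if ⌊ e ∈? H ⌋ then incid G e v else 0) (allFin (m G)))
  where open import Data.Fin.Subset.Properties using (_∈?_)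

IsFactor : (G : Graph) → SpanningSubgraph G → Set
IsFactor G H = ∀ v → deg G H v ≥ 1

Even : ℕ → Set
Even k = 2 ∣ k

Odd : ℕ → Set
Odd k = ¬ (2 ∣ k)

IsParityFactor : (G : Graph) → Subset (n G) → SpanningSubgraph G → Set
IsParityFactor G X H =
  IsFactor G H ×
  (∀ v → v ∈ X → Odd (deg G H v)) ×
  (∀ v → v ∉ X → Even (deg G H v))

StrongParity : Graph → Set
StrongParity G = ∀ (X : Subset (n G)) → Even ∣ X ∣ → ∃[ H ] IsParityFactor G X H

data Walk (G : Graph) : Vertex G → Vertex G → Set where
  here : ∀ {u} → Walk G u u
  step : ∀ {u w v} (e : Edge G) → Joins G e u w → Walk G w v → Walk G u v

Connected : Graph → Set
Connected G = ∀ (u v : Vertex G) → Walk G u v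

On2Cycle : (G : Graph) → Vertex G → Set
On2Cycle G v = ∃[ w ] ∃[ e ] ∃[ f ]
  (¬ v ≡ w) × (¬ e ≡ f) × Joins G e v w × Joins G f v w

-- v is incident with a 3-cycle: distinct vertices v, a, b pairwise joined
-- (the three edges are then automatically distinct)
On3Cycle : (G : Graph) → Vertex G → Set
On3Cycle G v = ∃[ a ] ∃[ b ] ∃[ e₁ ] ∃[ e₂ ] ∃[ e₃ ]
  (¬ v ≡ a) × (¬ v ≡ b) × (¬ a ≡ b) ×
  Joins G e₁ v a × Joins G e₂ a b × Joins G e₃ b v

-- Degree parities are computed in the two-element field (Bool, xor, ∧).
-- The proof has two independent halves.
--
-- Toggling an edge xy of a spanning subgraph flips the degree
-- parities exactly at x and y, so toggling the edges of a u–w walk flips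
-- them exactly at u and w, and toggling a closed walk changes nothing.  In a
-- connected graph the realisable parity vectors are therefore closed under
-- adding δ u + δ w for all u, w; since these vectors span the even-weight
-- vectors (evenWeight-generated), every even set X is the odd-degree set of
-- some spanning subgraph H (parity-subgraph).
--
-- If v has no edge of H, toggle a 2-cycle or triangle through v:
-- being a closed walk it keeps all parities, its edges at v are absent from
-- H and so get added, and every vertex covered before stays covered (only
-- the triangle's opposite edge can disappear, and its ends are then covered
-- by the edges at v).  Doing this for every vertex (cover-all) turns H into
-- an X-parity-factor.
module Submission where

open import Defs
open import Data.Nat using (ℕ; zero; suc; _+_; _*_; _≤_; _≥_; z≤n; s≤s)
open import Data.Nat.Properties using (m≤m+n; m≤n+m; ≤-trans)
open import Data.Nat.Divisibility using (divides; ∣-refl; ∣m∣n⇒∣m+n)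
open import Data.Nat.ListAction using (sum)
open import Data.Bool using (Bool; true; false; not; _∧_; _xor_; if_then_else_)
open import Data.Bool.Properties
  using (not-involutive; not-distribˡ-xor; xor-comm; xor-same; xor-identityʳ;
         ∧-comm; ∧-zeroʳ; ∧-identityʳ; ∧-distribˡ-xor; ∧-distribʳ-xor)
  renaming (_≟_ to _≟ᵇ_)
open import Data.Bool.Solver using (module xor-∧-Solver)
open import Data.Fin using (Fin; zero; suc; _≟_)
open import Data.Fin.Properties using (suc-injective; any?)
open import Data.Fin.Subset using (Subset; _∉_; ∣_∣)
open import Data.Fin.Subset.Properties using (_∈?_)
open import Data.Vec using (_∷_; []; lookup; updateAt; replicate)
open import Data.Vec.Properties
  using (lookup∘updateAt; lookup∘updateAt′; lookup-replicate; []=⇒lookup; lookup⇒[]=)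
open import Data.List using (List; []; _∷_; map; foldr; allFin)
open import Data.List.Properties using (map-tabulate; map-cong; map-∘)
open import Data.List.Membership.Propositional using (_∈_)
open import Data.List.Membership.Propositional.Properties using (∈-map⁺; ∈-allFin)
open import Data.List.Relation.Unary.Any using (here; there)
open import Data.List.Relation.Unary.All as All using (All; []; _∷_)
open import Data.Product using (_×_; _,_; proj₁; proj₂; ∃-syntax)
open import Data.Sum using (_⊎_; inj₁; inj₂; [_,_])
open import Data.Empty using (⊥-elim)
open import Function using (_∘_)
open import Relation.Nullary using (¬_; Dec; yes; no)
open import Relation.Nullary.Decidable
  using (⌊_⌋; ⌊⌋-map′; isYes≗does; dec-false; _×-dec_; _⊎-dec_)
open import Relation.Binary.PropositionalEquality
  using (_≡_; _≢_; ≢-sym; refl; sym; trans; cong; cong₂; subst; module ≡-Reasoning)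

open ≡-Reasoning

isOdd : ℕ → Bool
isOdd zero    = false
isOdd (suc k) = not (isOdd k)

isOdd-+ : ∀ a b → isOdd (a + b) ≡ isOdd a xor isOdd b
isOdd-+ zero    b = refl
isOdd-+ (suc a) b = trans (cong not (isOdd-+ a b)) (not-distribˡ-xor (isOdd a) (isOdd b))

even⇒isOdd≡false : ∀ {k} → Even k → isOdd k ≡ false
even⇒isOdd≡false (divides q refl) = isOdd-double q
  where
  isOdd-double : ∀ q → isOdd (q * 2) ≡ false
  isOdd-double zero    = refl
  isOdd-double (suc q) = trans (not-involutive _) (isOdd-double q)

isOdd≡false⇒even : ∀ {k} → isOdd k ≡ false → Even k
isOdd≡false⇒even {zero}          _ = divides 0 refl
isOdd≡false⇒even {suc zero}      ()
isOdd≡false⇒even {suc (suc k)} p =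
  ∣m∣n⇒∣m+n ∣-refl (isOdd≡false⇒even (trans (sym (not-involutive (isOdd k))) p))

isOdd≡true⇒odd : ∀ {k} → isOdd k ≡ true → Odd k
isOdd≡true⇒odd p 2∣k with () ← trans (sym p) (even⇒isOdd≡false 2∣k)

∈⇒≤sum : ∀ {k ns} → k ∈ ns → k ≤ sum ns
∈⇒≤sum {ns = k ∷ ns} (here refl) = m≤m+n k (sum ns)
∈⇒≤sum {ns = m ∷ ns} (there p)   = ≤-trans (∈⇒≤sum p) (m≤n+m (sum ns) m)

⨁ : List Bool → Bool
⨁ = foldr _xor_ false

isOdd-sum : ∀ ns → isOdd (sum ns) ≡ ⨁ (map isOdd ns)
isOdd-sum []       = refl
isOdd-sum (k ∷ ns) = trans (isOdd-+ k (sum ns)) (cong (isOdd k xor_) (isOdd-sum ns))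

⨁-xor : ∀ {A : Set} (f g : A → Bool) xs →
        ⨁ (map (λ x → f x xor g x) xs) ≡ ⨁ (map f xs) xor ⨁ (map g xs)
⨁-xor f g []       = refl
⨁-xor f g (x ∷ xs) = trans (cong ((f x xor g x) xor_) (⨁-xor f g xs))
                           (interchange (f x) (g x) (⨁ (map f xs)) (⨁ (map g xs)))
  where
  open xor-∧-Solver
  interchange : ∀ a b c d → (a xor b) xor (c xor d) ≡ (a xor c) xor (b xor d)
  interchange = solve 4 (λ a b c d → (a :+ b) :+ (c :+ d) := (a :+ c) :+ (b :+ d)) refl

⨁-∧ : ∀ {A : Set} (f : A → Bool) b xs → ⨁ (map (λ x → f x ∧ b) xs) ≡ ⨁ (map f xs) ∧ b
⨁-∧ f b []       = refl
⨁-∧ f b (x ∷ xs) = trans (cong ((f x ∧ b) xor_) (⨁-∧ f b xs))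
                         (sym (∧-distribʳ-xor b (f x) (⨁ (map f xs))))

δ : ∀ {k} → Fin k → Fin k → Bool
δ u v = ⌊ u ≟ v ⌋

map-allFin-suc : ∀ {A : Set} {k} (f : Fin (suc k) → A) →
                 map f (allFin (suc k)) ≡ f zero ∷ map (f ∘ suc) (allFin k)
map-allFin-suc f = cong (f zero ∷_) (trans (map-tabulate suc f) (sym (map-tabulate (λ i → i) (f ∘ suc))))

δ-suc : ∀ {k} (u v : Fin k) → δ (suc u) (suc v) ≡ δ u v
δ-suc u v = ⌊⌋-map′ (cong suc) suc-injective (u ≟ v)

⨁-δ : ∀ {k} (c : Fin k → Bool) v → ⨁ (map (λ u → c u ∧ δ u v) (allFin k)) ≡ c v
⨁-δ {suc k} c zero = begin
  ⨁ (map (λ u → c u ∧ δ u zero) (allFin (suc k)))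
    ≡⟨ cong ⨁ (map-allFin-suc (λ u → c u ∧ δ u zero)) ⟩
  (c zero ∧ true) xor ⨁ (map (λ u → c (suc u) ∧ false) (allFin k))
    ≡⟨ cong₂ _xor_ (∧-identityʳ (c zero)) (trans (⨁-∧ (c ∘ suc) false (allFin k)) (∧-zeroʳ _)) ⟩
  c zero xor false
    ≡⟨ xor-identityʳ (c zero) ⟩
  c zero ∎
⨁-δ {suc k} c (suc v) = begin
  ⨁ (map (λ u → c u ∧ δ u (suc v)) (allFin (suc k)))
    ≡⟨ cong ⨁ (map-allFin-suc (λ u → c u ∧ δ u (suc v))) ⟩
  (c zero ∧ false) xor ⨁ (map (λ u → c (suc u) ∧ δ (suc u) (suc v)) (allFin k))
    ≡⟨ cong₂ _xor_ (∧-zeroʳ (c zero)) (cong ⨁ (map-cong (λ u → cong (c (suc u) ∧_) (δ-suc u v)) (allFin k))) ⟩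
  ⨁ (map (λ u → c (suc u) ∧ δ u v) (allFin k))
    ≡⟨ ⨁-δ (c ∘ suc) v ⟩
  c (suc v) ∎

isOdd-∣∣ : ∀ {k} (X : Subset k) → isOdd ∣ X ∣ ≡ ⨁ (map (lookup X) (allFin k))
isOdd-∣∣ []          = refl
isOdd-∣∣ (true ∷ X)  = trans (cong not (isOdd-∣∣ X)) (sym (cong ⨁ (map-allFin-suc (lookup (true ∷ X)))))
isOdd-∣∣ (false ∷ X) = trans (isOdd-∣∣ X) (sym (cong ⨁ (map-allFin-suc (lookup (false ∷ X)))))

-- Linear algebra over the two-element field: the vectors δ u + δ w span
-- the even-weight vectors.
evenWeight-generated : ∀ {k} (Q : (Fin k → Bool) → Set) →
  (∀ {f g} → (∀ v → f v ≡ g v) → Q f → Q g) →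
  Q (λ _ → false) →
  (∀ {f} u w → Q f → Q (λ v → f v xor (δ u v xor δ w v))) →
  ∀ X → Even ∣ X ∣ → Q (lookup X)
evenWeight-generated {zero}  Q Q-resp Q-zero Q-pair X even = Q-resp (λ ()) Q-zero
evenWeight-generated {suc k} Q Q-resp Q-zero Q-pair X even =
  Q-resp combination≡X (combination (allFin (suc k)))
  where
  -- the combination Σ_{u ∈ L} X_u (δ u + δ zero), with zero as the common partner
  comb : List (Fin (suc k)) → Fin (suc k) → Bool
  comb L v = ⨁ (map (λ u → lookup X u ∧ (δ u v xor δ zero v)) L)

  combination : ∀ L → Q (comb L)
  combination []      = Q-zero
  combination (u ∷ L) with lookup X u
  ... | true  = Q-resp (λ v → xor-comm (comb L v) _) (Q-pair u zero (combination L))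
  ... | false = combination L

  -- the δ zero terms cancel because X has even size
  combination≡X : ∀ v → comb (allFin (suc k)) v ≡ lookup X v
  combination≡X v = begin
    comb (allFin (suc k)) v
      ≡⟨ cong ⨁ (map-cong (λ u → ∧-distribˡ-xor (lookup X u) (δ u v) (δ zero v)) (allFin (suc k))) ⟩
    ⨁ (map (λ u → (lookup X u ∧ δ u v) xor (lookup X u ∧ δ zero v)) (allFin (suc k)))
      ≡⟨ ⨁-xor (λ u → lookup X u ∧ δ u v) (λ u → lookup X u ∧ δ zero v) (allFin (suc k)) ⟩
    ⨁ (map (λ u → lookup X u ∧ δ u v) (allFin (suc k))) xor
    ⨁ (map (λ u → lookup X u ∧ δ zero v) (allFin (suc k)))
      ≡⟨ cong₂ _xor_ (⨁-δ (lookup X) v) (⨁-∧ (lookup X) (δ zero v) (allFin (suc k))) ⟩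
    lookup X v xor (⨁ (map (lookup X) (allFin (suc k))) ∧ δ zero v)
      ≡⟨ cong (λ b → lookup X v xor (b ∧ δ zero v)) (trans (sym (isOdd-∣∣ X)) (even⇒isOdd≡false even)) ⟩
    lookup X v xor false
      ≡⟨ xor-identityʳ (lookup X v) ⟩
    lookup X v ∎

-- Membership test and characteristic vector of a subset agree (degrees are
-- defined through the former, toggling acts on the latter).
∈?≡lookup : ∀ {k} (e : Fin k) (H : Subset k) → ⌊ e ∈? H ⌋ ≡ lookup H e
∈?≡lookup e H with e ∈? H
... | yes e∈H = sym ([]=⇒lookup e∈H)
... | no  e∉H with lookup H e in eq
...   | true  = ⊥-elim (e∉H (lookup⇒[]= e H eq))
...   | false = refl

∉⇒lookup≡false : ∀ {k} {v : Fin k} {X : Subset k} → v ∉ X → lookup X v ≡ false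
∉⇒lookup≡false {v = v} {X} v∉X =
  trans (sym (∈?≡lookup v X)) (trans (isYes≗does (v ∈? X)) (dec-false (v ∈? X) v∉X))

module _ (G : Graph) where

  isOdd-incid : ∀ e v →
    isOdd (incid G e v) ≡ δ (proj₁ (ends G e)) v xor δ (proj₂ (ends G e)) v
  isOdd-incid e v =
    trans (isOdd-+ (indicator (δ x v)) (indicator (δ y v)))
          (cong₂ _xor_ (isOdd-indicator (δ x v)) (isOdd-indicator (δ y v)))
    where
    x = proj₁ (ends G e)
    y = proj₂ (ends G e)
    indicator : Bool → ℕ
    indicator b = if b then 1 else 0
    isOdd-indicator : ∀ b → isOdd (indicator b) ≡ b
    isOdd-indicator true  = refl
    isOdd-indicator false = refl

  isOdd-incid-joins : ∀ {e x y} → Joins G e x y → ∀ v → isOdd (incid G e v) ≡ δ x v xor δ y v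
  isOdd-incid-joins {e} (inj₁ eq) v =
    trans (isOdd-incid e v) (cong (λ p → δ (proj₁ p) v xor δ (proj₂ p) v) eq)
  isOdd-incid-joins {e} {x} {y} (inj₂ eq) v =
    trans (isOdd-incid e v) (trans (cong (λ p → δ (proj₁ p) v xor δ (proj₂ p) v) eq) (xor-comm (δ y v) (δ x v)))

  isOdd-deg : ∀ H v →
    isOdd (deg G H v) ≡ ⨁ (map (λ e → lookup H e ∧ isOdd (incid G e v)) (allFin (m G)))
  isOdd-deg H v = begin
    isOdd (sum (map term (allFin (m G))))  ≡⟨ isOdd-sum (map term (allFin (m G))) ⟩
    ⨁ (map isOdd (map term (allFin (m G)))) ≡⟨ cong ⨁ (sym (map-∘ (allFin (m G)))) ⟩
    ⨁ (map (λ e → isOdd (term e)) (allFin (m G))) ≡⟨ cong ⨁ (map-cong isOdd-term (allFin (m G))) ⟩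
    ⨁ (map (λ e → lookup H e ∧ isOdd (incid G e v)) (allFin (m G))) ∎
    where
    term : Edge G → ℕ
    term e = if ⌊ e ∈? H ⌋ then incid G e v else 0
    isOdd-term : ∀ e → isOdd (term e) ≡ lookup H e ∧ isOdd (incid G e v)
    isOdd-term e rewrite ∈?≡lookup e H with lookup H e
    ... | true  = refl
    ... | false = refl

  toggle : SpanningSubgraph G → Edge G → SpanningSubgraph G
  toggle H e = updateAt H e not

  toggle-keeps : ∀ H {e g b} → g ≢ e → lookup H g ≡ b → lookup (toggle H e) g ≡ b
  toggle-keeps H {e} {g} g≢e Hg = trans (lookup∘updateAt′ g e g≢e H) Hg

  toggle-adds : ∀ H {e} → lookup H e ≡ false → lookup (toggle H e) e ≡ true
  toggle-adds H {e} He = trans (lookup∘updateAt e H) (cong not He)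

  lookup-toggle : ∀ H e g → lookup (toggle H e) g ≡ lookup H g xor δ g e
  lookup-toggle H e g with g ≟ e
  ... | yes refl = trans (lookup∘updateAt g H) (xor-comm true (lookup H g))
  ... | no  g≢e  = toggle-keeps H g≢e (sym (xor-identityʳ (lookup H g)))

  toggle-parity : ∀ {e x y} → Joins G e x y → ∀ H v →
    isOdd (deg G (toggle H e) v) ≡ isOdd (deg G H v) xor (δ x v xor δ y v)
  toggle-parity {e} {x} {y} j H v = begin
    isOdd (deg G (toggle H e) v)
      ≡⟨ isOdd-deg (toggle H e) v ⟩
    ⨁ (map (λ g → lookup (toggle H e) g ∧ p g) edges)
      ≡⟨ cong ⨁ (map-cong split edges) ⟩
    ⨁ (map (λ g → (lookup H g ∧ p g) xor (p g ∧ δ g e)) edges)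
      ≡⟨ ⨁-xor (λ g → lookup H g ∧ p g) (λ g → p g ∧ δ g e) edges ⟩
    ⨁ (map (λ g → lookup H g ∧ p g) edges) xor ⨁ (map (λ g → p g ∧ δ g e) edges)
      ≡⟨ cong₂ _xor_ (sym (isOdd-deg H v)) (⨁-δ p e) ⟩
    isOdd (deg G H v) xor p e
      ≡⟨ cong (isOdd (deg G H v) xor_) (isOdd-incid-joins j v) ⟩
    isOdd (deg G H v) xor (δ x v xor δ y v) ∎
    where
    edges = allFin (m G)
    p : Edge G → Bool
    p g = isOdd (incid G g v)
    split : ∀ g → lookup (toggle H e) g ∧ p g ≡ (lookup H g ∧ p g) xor (p g ∧ δ g e)
    split g = begin
      lookup (toggle H e) g ∧ p g          ≡⟨ cong (_∧ p g) (lookup-toggle H e g) ⟩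
      (lookup H g xor δ g e) ∧ p g         ≡⟨ ∧-distribʳ-xor (p g) (lookup H g) (δ g e) ⟩
      (lookup H g ∧ p g) xor (δ g e ∧ p g) ≡⟨ cong ((lookup H g ∧ p g) xor_) (∧-comm (δ g e) (p g)) ⟩
      (lookup H g ∧ p g) xor (p g ∧ δ g e) ∎

  toggleWalk : ∀ {u w} → SpanningSubgraph G → Walk G u w → SpanningSubgraph G
  toggleWalk H here           = H
  toggleWalk H (step e _ walk) = toggleWalk (toggle H e) walk

  -- Toggling the edges of a u–w walk flips the degree parities exactly at u
  -- and w: inner vertices are flipped twice per visit.
  toggleWalk-parity : ∀ {u w} (walk : Walk G u w) H v →
    isOdd (deg G (toggleWalk H walk) v) ≡ isOdd (deg G H v) xor (δ u v xor δ w v)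
  toggleWalk-parity {u} here H v = sym (xor-cancel (isOdd (deg G H v)) (δ u v))
    where
    xor-cancel : ∀ a b → a xor (b xor b) ≡ a
    xor-cancel a b = trans (cong (a xor_) (xor-same b)) (xor-identityʳ a)
  toggleWalk-parity {u} {w} (step {w = z} e j walk) H v = begin
    isOdd (deg G (toggleWalk (toggle H e) walk) v)
      ≡⟨ toggleWalk-parity walk (toggle H e) v ⟩
    isOdd (deg G (toggle H e) v) xor (δ z v xor δ w v)
      ≡⟨ cong (_xor (δ z v xor δ w v)) (toggle-parity j H v) ⟩
    (isOdd (deg G H v) xor (δ u v xor δ z v)) xor (δ z v xor δ w v)
      ≡⟨ telescope (isOdd (deg G H v)) (δ u v) (δ z v) (δ w v) ⟩
    isOdd (deg G H v) xor (δ u v xor δ w v) ∎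
    where
    open xor-∧-Solver
    telescope : ∀ a b c d → (a xor (b xor c)) xor (c xor d) ≡ a xor (b xor d)
    telescope = solve 4 (λ a b c d → (a :+ (b :+ c)) :+ (c :+ d) := a :+ (b :+ d)) refl

  closedWalk-parity : ∀ {u} (walk : Walk G u u) H v →
    isOdd (deg G (toggleWalk H walk) v) ≡ isOdd (deg G H v)
  closedWalk-parity {u} walk H v =
    trans (toggleWalk-parity walk H v)
          (trans (cong (isOdd (deg G H v) xor_) (xor-same (δ u v))) (xor-identityʳ _))

  Realisable : (Vertex G → Bool) → Set
  Realisable f = ∃[ H ] (∀ v → isOdd (deg G H v) ≡ f v)

  realisable-resp : ∀ {f g} → (∀ v → f v ≡ g v) → Realisable f → Realisable g
  realisable-resp f≗g (H , parityH) = H , λ v → trans (parityH v) (f≗g v)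

  realisable-zero : Realisable (λ _ → false)
  realisable-zero = replicate (m G) false , λ v → begin
    isOdd (deg G (replicate (m G) false) v)
      ≡⟨ isOdd-deg (replicate (m G) false) v ⟩
    ⨁ (map (λ e → lookup (replicate (m G) false) e ∧ isOdd (incid G e v)) (allFin (m G)))
      ≡⟨ cong ⨁ (map-cong (λ e → cong (_∧ isOdd (incid G e v)) (lookup-replicate e false)) (allFin (m G))) ⟩
    ⨁ (map (λ e → false ∧ isOdd (incid G e v)) (allFin (m G)))
      ≡⟨ trans (⨁-∧ (λ _ → false) false (allFin (m G))) (∧-zeroʳ _) ⟩
    false ∎

  realisable-walk : ∀ {u w f} → Walk G u w → Realisable f →
    Realisable (λ v → f v xor (δ u v xor δ w v))
  realisable-walk walk (H , parityH) =
    toggleWalk H walk , λ v → trans (toggleWalk-parity walk H v) (cong (_xor _) (parityH v))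

  parity-subgraph : Connected G → ∀ X → Even ∣ X ∣ → Realisable (lookup X)
  parity-subgraph connected =
    evenWeight-generated Realisable realisable-resp realisable-zero
      (λ u w → realisable-walk (connected u w))

  joins-sym : ∀ {e x y} → Joins G e x y → Joins G e y x
  joins-sym (inj₁ eq) = inj₂ eq
  joins-sym (inj₂ eq) = inj₁ eq

  Touches : Edge G → Vertex G → Set
  Touches e v = proj₁ (ends G e) ≡ v ⊎ proj₂ (ends G e) ≡ v

  joins⇒touches : ∀ {e x y} → Joins G e x y → Touches e x
  joins⇒touches (inj₁ eq) = inj₁ (cong proj₁ eq)
  joins⇒touches (inj₂ eq) = inj₂ (cong proj₂ eq)

  touches-joins : ∀ {e a b u} → Joins G e a b → Touches e u → u ≡ a ⊎ u ≡ b
  touches-joins (inj₁ eq) (inj₁ t) = inj₁ (trans (sym t) (cong proj₁ eq))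
  touches-joins (inj₁ eq) (inj₂ t) = inj₂ (trans (sym t) (cong proj₂ eq))
  touches-joins (inj₂ eq) (inj₁ t) = inj₂ (trans (sym t) (cong proj₁ eq))
  touches-joins (inj₂ eq) (inj₂ t) = inj₁ (trans (sym t) (cong proj₂ eq))

  not-between : ∀ {e g a b u} → Joins G e a b → Touches g u → u ≢ a → u ≢ b → g ≢ e
  not-between j t u≢a u≢b refl = [ u≢a , u≢b ] (touches-joins j t)

  touches⇒incid : ∀ {e v} → Touches e v → incid G e v ≥ 1
  touches⇒incid {e} {v} (inj₁ eq) with proj₁ (ends G e) ≟ v
  ... | yes _ = s≤s z≤n
  ... | no ne = ⊥-elim (ne eq)
  touches⇒incid {e} {v} (inj₂ eq) with proj₂ (ends G e) ≟ v
  ... | yes _ = m≤n+m 1 _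
  ... | no ne = ⊥-elim (ne eq)

  Covered : SpanningSubgraph G → Vertex G → Set
  Covered H v = ∃[ e ] (lookup H e ≡ true × Touches e v)

  covered? : ∀ H v → Dec (Covered H v)
  covered? H v = any? λ e →
    (lookup H e ≟ᵇ true) ×-dec ((proj₁ (ends G e) ≟ v) ⊎-dec (proj₂ (ends G e) ≟ v))

  covered⇒deg : ∀ {H v} → Covered H v → deg G H v ≥ 1
  covered⇒deg {H} {v} (e , He , t) =
    ≤-trans (touches⇒incid t)
            (subst (_≤ deg G H v) term≡incid (∈⇒≤sum (∈-map⁺ term (∈-allFin e))))
    where
    term : Edge G → ℕ
    term e = if ⌊ e ∈? H ⌋ then incid G e v else 0
    term≡incid : term e ≡ incid G e v
    term≡incid = cong (λ b → if b then incid G e v else 0) (trans (∈?≡lookup e H) He)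

  absent-at-uncovered : ∀ H {v e} → ¬ Covered H v → Touches e v → lookup H e ≡ false
  absent-at-uncovered H {e = e} uncovered t with lookup H e in eq
  ... | true  = ⊥-elim (uncovered (e , eq , t))
  ... | false = refl

  present≢absent : ∀ H {g e : Edge G} → lookup H g ≡ true → lookup H e ≡ false → g ≢ e
  present≢absent H Hg He refl with () ← trans (sym Hg) He

  record CoverExtension (H : SpanningSubgraph G) (v : Vertex G) : Set where
    field
      extension  : SpanningSubgraph G
      sameParity : ∀ u → isOdd (deg G extension u) ≡ isOdd (deg G H u)
      coversV    : Covered extension v
      keeps      : ∀ {u} → Covered H u → Covered extension u

  cover-by-2-cycle : ∀ {H v} → ¬ Covered H v → On2Cycle G v → CoverExtension H v
  cover-by-2-cycle {H} {v} uncovered (_ , e , f , _ , e≢f , je , jf) = record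
    { extension  = toggleWalk H cycle
    ; sameParity = closedWalk-parity cycle H
    ; coversV    = e , toggle-keeps (toggle H e) e≢f (toggle-adds H He) , joins⇒touches je
    ; keeps      = keep
    }
    where
    cycle : Walk G v v
    cycle = step e je (step f (joins-sym jf) here)
    He : lookup H e ≡ false
    He = absent-at-uncovered H uncovered (joins⇒touches je)
    Hf : lookup H f ≡ false
    Hf = absent-at-uncovered H uncovered (joins⇒touches jf)
    keep : ∀ {u} → Covered H u → Covered (toggleWalk H cycle) u
    keep (g , Hg , t) =
      g , toggle-keeps (toggle H e) (present≢absent H Hg Hf) (toggle-keeps H (present≢absent H Hg He) Hg) , t

  -- The
  -- edges at v are absent, so they get added; the edge ab may be removed, but
  -- its ends a and b are then covered by the edges va and bv.
  cover-by-3-cycle : ∀ {H v} → ¬ Covered H v → On3Cycle G v → CoverExtension H v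
  cover-by-3-cycle {H} {v} uncovered (a , b , e₁ , e₂ , e₃ , v≢a , v≢b , a≢b , j₁ , j₂ , j₃) = record
    { extension  = toggleWalk H cycle
    ; sameParity = closedWalk-parity cycle H
    ; coversV    = e₁ , e₁∈H′ , joins⇒touches j₁
    ; keeps      = keep
    }
    where
    cycle : Walk G v v
    cycle = step e₁ j₁ (step e₂ j₂ (step e₃ j₃ here))
    H₁ H₂ : SpanningSubgraph G
    H₁ = toggle H e₁
    H₂ = toggle H₁ e₂
    e₁≢e₂ : e₁ ≢ e₂
    e₁≢e₂ = not-between j₂ (joins⇒touches j₁) v≢a v≢b
    e₃≢e₂ : e₃ ≢ e₂
    e₃≢e₂ = not-between j₂ (joins⇒touches (joins-sym j₃)) v≢a v≢b
    e₁≢e₃ : e₁ ≢ e₃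
    e₁≢e₃ = not-between j₃ (joins⇒touches (joins-sym j₁)) a≢b (≢-sym v≢a)
    He₁ : lookup H e₁ ≡ false
    He₁ = absent-at-uncovered H uncovered (joins⇒touches j₁)
    He₃ : lookup H e₃ ≡ false
    He₃ = absent-at-uncovered H uncovered (joins⇒touches (joins-sym j₃))
    e₁∈H′ : lookup (toggle H₂ e₃) e₁ ≡ true
    e₁∈H′ = toggle-keeps H₂ e₁≢e₃ (toggle-keeps H₁ e₁≢e₂ (toggle-adds H He₁))
    e₃∈H′ : lookup (toggle H₂ e₃) e₃ ≡ true
    e₃∈H′ = toggle-adds H₂ (toggle-keeps H₁ e₃≢e₂ (toggle-keeps H (≢-sym e₁≢e₃) He₃))
    keep : ∀ {u} → Covered H u → Covered (toggle H₂ e₃) u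
    keep (g , Hg , t) with g ≟ e₂
    ... | no g≢e₂ = g , toggle-keeps H₂ (present≢absent H Hg He₃)
                          (toggle-keeps H₁ g≢e₂ (toggle-keeps H (present≢absent H Hg He₁) Hg)) , t
    ... | yes refl with touches-joins j₂ t
    ...   | inj₁ refl = e₁ , e₁∈H′ , joins⇒touches (joins-sym j₁)
    ...   | inj₂ refl = e₃ , e₃∈H′ , joins⇒touches j₃

  cover-uncovered : ∀ {H v} → ¬ Covered H v → On2Cycle G v ⊎ On3Cycle G v → CoverExtension H v
  cover-uncovered uncovered = [ cover-by-2-cycle uncovered , cover-by-3-cycle uncovered ]

  cover-all : (∀ v → On2Cycle G v ⊎ On3Cycle G v) → ∀ H (L : List (Vertex G)) →
    ∃[ H′ ] ((∀ u → isOdd (deg G H′ u) ≡ isOdd (deg G H u)) × All (Covered H′) L)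
  cover-all cycles H []      = H , (λ _ → refl) , []
  cover-all cycles H (v ∷ L) with cover-all cycles H L
  ... | H₁ , same₁ , covered₁ with covered? H₁ v
  ...   | yes covered = H₁ , same₁ , covered ∷ covered₁
  ...   | no uncovered =
    extension , (λ u → trans (sameParity u) (same₁ u)) , coversV ∷ All.map keeps covered₁
    where open CoverExtension (cover-uncovered {H₁} uncovered (cycles v))

  parity-factor : ∀ X H → (∀ v → Covered H v) → (∀ v → isOdd (deg G H v) ≡ lookup X v) →
    IsParityFactor G X H
  parity-factor X H covered parityH =
      (λ v → covered⇒deg (covered v))
    , (λ v v∈X → isOdd≡true⇒odd (trans (parityH v) ([]=⇒lookup v∈X)))
    , (λ v v∉X → isOdd≡false⇒even (trans (parityH v) (∉⇒lookup≡false v∉X)))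

mainTheorem7 : (G : Graph) → Connected G →
    (∀ v → On2Cycle G v ⊎ On3Cycle G v) → StrongParity G
mainTheorem7 G connected cycles X even =
  let H  , parityH          = parity-subgraph G connected X even
      H′ , sameParity , cov = cover-all G cycles H (allFin (n G))
  in H′ , parity-factor G X H′ (λ v → All.lookup cov (∈-allFin v))
                                (λ v → trans (sameParity v) (parityH v))
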